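{- Let $G$ be an abelian group (written additively), $\phi$ an automorphism of $G$ whose order is not divisible by $3$, and $K$ a $\phi$-invariant subgroup of index $4$ in $G$. Then $G$ contains a $\phi$-invariant subgroup $H$ of index $2$ with $K\leqslant H$. Consequently, $\mathrm{Im}_G(1+\phi+\phi^2+\phi^3)\leqslant K$.
   Context: For an endomorphism $f$ of $G$, $\mathrm{Im}_G(f)=\{f(g):g\in G\}$; $(1+\phi+\phi^2+\phi^3)(g)=g+\phi(g)+\phi^2(g)+\phi^3(g)$. -}

module Defs where

open import Level using (Level; _⊔_; suc)
open import Data.Nat using (ℕ; zero; suc; _<_)
open import Data.Nat.Divisibility using (_∣_)
open import Data.Fin using (Fin)
open import Data.Product using (Σ; ∃; _×_; _,_)
open import Relation.Nullary using (¬_)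
open import Relation.Binary.PropositionalEquality using (_≡_)
open import Relation.Unary using (Pred; _⊆_)
open import Algebra.Bundles using (AbelianGroup)
open import Algebra.Morphism.Structures using (module GroupMorphisms)

module _ {c ℓ : Level} (G : AbelianGroup c ℓ) where
  open AbelianGroup G

  -- automorphism of G (G written with the stdlib's operation _∙_, unit ε, inverse _⁻¹;
  -- this is the additive group operation +, 0, -)
  IsAutomorphism : (Carrier → Carrier) → Set (c ⊔ ℓ)
  IsAutomorphism φ = GroupMorphisms.IsGroupIsomorphism rawGroup rawGroup φ

  iter : ℕ → (Carrier → Carrier) → Carrier → Carrier
  iter zero    φ x = x
  iter (suc n) φ x = φ (iter n φ x)

  IsIdentity : (Carrier → Carrier) → Set (c ⊔ ℓ)
  IsIdentity f = ∀ x → f x ≈ x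

  HasOrder : (Carrier → Carrier) → ℕ → Set (c ⊔ ℓ)
  HasOrder φ n = (0 < n) × IsIdentity (iter n φ) × (∀ m → 0 < m → m < n → ¬ IsIdentity (iter m φ))

  record IsSubgroup {p : Level} (K : Pred Carrier p) : Set (c ⊔ ℓ ⊔ p) where
    field
      resp   : ∀ {x y} → x ≈ y → K x → K y
      ε-mem  : K ε
      ∙-mem  : ∀ {x y} → K x → K y → K (x ∙ y)
      ⁻¹-mem : ∀ {x} → K x → K (x ⁻¹)

  Invariant : {p : Level} → (Carrier → Carrier) → Pred Carrier p → Set (c ⊔ p)
  Invariant φ K = ∀ {x} → K x → K (φ x)

  -- K has index n in G: there are n coset representatives g₀,…,g_{n-1}
  -- such that every element lies in exactly one coset g_i K (|G/K| = n).
  HasIndex : {p : Level} → Pred Carrier p → ℕ → Set (c ⊔ p)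
  HasIndex K n = Σ (Fin n → Carrier) λ g →
      (∀ x → ∃ λ i → K (x ∙ (g i) ⁻¹))
    × (∀ i j → K (g i ∙ (g j) ⁻¹) → i ≡ j)

  ImageIn : {p : Level} → (Carrier → Carrier) → Pred Carrier p → Set (c ⊔ p)
  ImageIn f K = ∀ g → K (f g)

  onePhi3 : (Carrier → Carrier) → Carrier → Carrier
  onePhi3 φ g = g ∙ (φ g ∙ (iter 2 φ g ∙ iter 3 φ g))

-- Pass to Q = G/K, an abelian group of order 4 on which φ induces an automorphism whose order
-- divides n. By Lagrange 4x = 0 on Q, and Q contains some v ≠ 0 with 2v = 0 and φ v = v: if some
-- x has 2x ≠ 0, take v = 2x, the only nonzero element of 2Q; otherwise Q is a Klein four-group,
-- φ permutes its three nonzero elements, and this permutation is not a 3-cycle because 3 ∤ n.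
-- The preimage H of {0, v} has index 2. Moreover φ acts trivially on G/H and on H/K, both of
-- exponent 2, so d = φ y − y lies in H/K and is fixed by φ, whence (1 + φ + φ² + φ³) y = 4y + 6d
-- vanishes in Q.
module Submission where

open import Level using (Level; _⊔_)
open import Data.Nat using (ℕ; zero; suc; _<_; _≤_; s≤s; z≤n)
open import Data.Nat.Properties using (<⇒≱; 1+n≰n)
open import Data.Nat.Divisibility using (_∣_; _∣0; ∣m∣n⇒∣m+n; ∣-refl)
open import Data.Fin using (Fin; zero; suc)
open import Data.Fin.Patterns using (0F; 1F; 2F; 3F)
open import Data.Fin.Permutation using (Permutation′; permutation; _⟨$⟩ʳ_)
import Data.Fin.Properties as Fin
open import Data.Vec.Functional using ([]; _∷_)
open import Data.Product using (Σ; ∃; _×_; _,_; proj₁; proj₂)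
open import Data.Sum using (_⊎_; inj₁; inj₂; [_,_]; [_,_]′)
open import Data.Empty using (⊥-elim)
open import Function.Definitions using (Injective)
open import Relation.Nullary using (¬_; yes; no; ¬?)
open import Relation.Nullary.Decidable using (map′; decidable-stable)
open import Relation.Nullary.Negation using (contradiction)
open import Relation.Binary.Bundles using (Setoid)
open import Relation.Binary.Definitions using (Decidable)
open import Relation.Binary.PropositionalEquality as ≡ using (_≡_)
open import Relation.Unary using (Pred; _⊆_)
open import Algebra.Bundles using (AbelianGroup)
open import Algebra.Morphism.Structures using (module GroupMorphisms)
import Algebra.Properties.Group as GroupProperties
import Algebra.Properties.AbelianGroup as AbelianGroupProperties
import Algebra.Properties.CommutativeSemigroup as CommutativeSemigroupProperties
import Algebra.Properties.CommutativeMonoid.Sum as CommutativeMonoidSum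
import Algebra.Solver.CommutativeMonoid as CommutativeMonoidSolver
import Relation.Binary.Reasoning.Setoid as SetoidReasoning

open import Defs

open GroupMorphisms using (IsGroupHomomorphism; IsGroupMonomorphism)

module Injections {a ℓ} (S : Setoid a ℓ) where
  open Setoid S

  ∷-injective : ∀ {k x} {ys : Fin k → Carrier} → (∀ j → ¬ x ≈ ys j) →
                Injective _≡_ _≈_ ys → Injective _≡_ _≈_ (x ∷ ys)
  ∷-injective x∉ys ys-injective {zero}  {zero}  _ = ≡.refl
  ∷-injective x∉ys ys-injective {zero}  {suc j} e = ⊥-elim (x∉ys j e)
  ∷-injective x∉ys ys-injective {suc i} {zero}  e = ⊥-elim (x∉ys i (sym e))
  ∷-injective x∉ys ys-injective {suc i} {suc j} e = ≡.cong suc (ys-injective e)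

record Enumeration {a ℓ} (S : Setoid a ℓ) (n : ℕ) : Set (a ⊔ ℓ) where
  open Setoid S
  open Injections S
  field
    element            : Fin n → Carrier
    element-injective  : Injective _≡_ _≈_ element
    element-surjective : ∀ x → ∃ λ i → x ≈ element i

  index : Carrier → Fin n
  index x = proj₁ (element-surjective x)

  x≈element[index] : ∀ x → x ≈ element (index x)
  x≈element[index] x = proj₂ (element-surjective x)

  index≡⇒≈ : ∀ {x y} → index x ≡ index y → x ≈ y
  index≡⇒≈ {x} {y} eq =
    trans (x≈element[index] x) (trans (reflexive (≡.cong element eq)) (sym (x≈element[index] y)))

  ≈⇒index≡ : ∀ {x y} → x ≈ y → index x ≡ index y
  ≈⇒index≡ {x} {y} x≈y =
    element-injective (trans (sym (x≈element[index] x)) (trans x≈y (x≈element[index] y)))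

  infix 4 _≟_
  _≟_ : Decidable _≈_
  x ≟ y = map′ index≡⇒≈ ≈⇒index≡ (index x Fin.≟ index y)

  injective⇒≤ : ∀ {m} {zs : Fin m → Carrier} → Injective _≡_ _≈_ zs → m ≤ n
  injective⇒≤ zs-injective = Fin.injective⇒≤ (λ eq → zs-injective (index≡⇒≈ eq))

  injective⇒surjective : {ys : Fin n → Carrier} → Injective _≡_ _≈_ ys → ∀ x → ∃ λ j → x ≈ ys j
  injective⇒surjective {ys} ys-injective x with Fin.any? (λ j → x ≟ ys j)
  ... | yes found = found
  ... | no x∉ys = contradiction (injective⇒≤ (∷-injective (λ j e → x∉ys (j , e)) ys-injective)) 1+n≰n

  ∃-missing : ∀ {k} → k < n → (ys : Fin k → Carrier) → ∃ λ x → ∀ j → ¬ x ≈ ys j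
  ∃-missing {k} k<n ys with Fin.all? (λ i → Fin.any? (λ j → element i ≟ ys j))
  ... | yes covered = contradiction (Fin.injective⇒≤ position-injective) (<⇒≱ k<n)
    where
    position-injective : Injective _≡_ _≡_ (λ i → proj₁ (covered i))
    position-injective {i} {i′} eq = element-injective
      (trans (proj₂ (covered i)) (trans (reflexive (≡.cong ys eq)) (sym (proj₂ (covered i′)))))
  ... | no ¬covered with Fin.¬∀⟶∃¬ n _ (λ i → Fin.any? (λ j → element i ≟ ys j)) ¬covered
  ...   | i , i∉ys = element i , λ j e → i∉ys (j , e)

module FiniteAbelianGroup {a ℓ} (A : AbelianGroup a ℓ) {n : ℕ} (E : Enumeration (AbelianGroup.setoid A) n) where
  open AbelianGroup A
  open Enumeration E using (element; element-injective; index; x≈element[index])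
  open GroupProperties group using (∙-cancelʳ)
  open CommutativeMonoidSum commutativeMonoid using (sum-syntax; ∑-permute; ∑-distrib-+; sum-cong-≋; sum-replicate)
  open import Algebra.Definitions.RawMonoid rawMonoid using () renaming (_×_ to _·_)
  open SetoidReasoning setoid

  translation : Carrier → Permutation′ n
  translation x = permutation (λ i → index (x ∙ element i)) (λ i → index (x ⁻¹ ∙ element i))
                    (translate-back x (x ⁻¹) (inverseʳ x)) (translate-back (x ⁻¹) x (inverseˡ x))
    where
    translate-back : ∀ y z → y ∙ z ≈ ε → ∀ i → index (y ∙ element (index (z ∙ element i))) ≡ i
    translate-back y z yz≈ε i = element-injective (begin
      element (index (y ∙ element (index (z ∙ element i))))  ≈⟨ x≈element[index] _ ⟨
      y ∙ element (index (z ∙ element i))                    ≈⟨ ∙-congˡ (x≈element[index] _) ⟨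
      y ∙ (z ∙ element i)                                    ≈⟨ assoc y z (element i) ⟨
      (y ∙ z) ∙ element i                                    ≈⟨ ∙-congʳ yz≈ε ⟩
      ε ∙ element i                                          ≈⟨ identityˡ (element i) ⟩
      element i                                              ∎)

  -- Translation by x permutes the elements, so ∑ (x ∙ eᵢ) = ∑ eᵢ.
  n·x≈ε : ∀ x → n · x ≈ ε
  n·x≈ε x = ∙-cancelʳ (∑[ i < n ] element i) (n · x) ε (begin
    n · x ∙ ∑[ i < n ] element i                    ≈⟨ ∙-congʳ (sum-replicate n) ⟨
    ∑[ i < n ] x ∙ ∑[ i < n ] element i             ≈⟨ ∑-distrib-+ (λ _ → x) element ⟨
    ∑[ i < n ] (x ∙ element i)                      ≈⟨ sum-cong-≋ (λ i → x≈element[index] (x ∙ element i)) ⟩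
    ∑[ i < n ] element (translation x ⟨$⟩ʳ i)       ≈⟨ ∑-permute element (translation x) ⟨
    ∑[ i < n ] element i                            ≈⟨ identityˡ _ ⟨
    ε ∙ ∑[ i < n ] element i                        ∎)

x∙ε⁻¹≈x : ∀ {a ℓ} (A : AbelianGroup a ℓ) → let open AbelianGroup A in ∀ x → x ∙ ε ⁻¹ ≈ x
x∙ε⁻¹≈x A x = trans (∙-congˡ ε⁻¹≈ε) (identityʳ x)
  where
  open AbelianGroup A
  open GroupProperties group using (ε⁻¹≈ε)

TwoCosets : ∀ {a ℓ h} (A : AbelianGroup a ℓ) → Pred (AbelianGroup.Carrier A) h → AbelianGroup.Carrier A → Set (a ⊔ h)
TwoCosets A H w = ∀ y → H y ⊎ H (y ∙ w ⁻¹)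
  where open AbelianGroup A

module Involution {a ℓ} (A : AbelianGroup a ℓ) {v : AbelianGroup.Carrier A} where
  open AbelianGroup A
  open GroupProperties group using (ε⁻¹≈ε; inverseʳ-unique)

  ⟨v⟩ : Pred Carrier ℓ
  ⟨v⟩ y = y ≈ ε ⊎ y ≈ v

  module _ (v∙v≈ε : v ∙ v ≈ ε) where

    ⟨v⟩-isSubgroup : IsSubgroup A ⟨v⟩
    ⟨v⟩-isSubgroup = record
      { resp   = λ x≈y → [ (λ e → inj₁ (trans (sym x≈y) e)) , (λ e → inj₂ (trans (sym x≈y) e)) ]
      ; ε-mem  = inj₁ refl
      ; ∙-mem  = ∙-mem
      ; ⁻¹-mem = [ (λ e → inj₁ (trans (⁻¹-cong e) ε⁻¹≈ε))
                 , (λ e → inj₂ (trans (⁻¹-cong e) (sym (inverseʳ-unique v v v∙v≈ε)))) ]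
      }
      where
      ∙-mem : ∀ {x y} → ⟨v⟩ x → ⟨v⟩ y → ⟨v⟩ (x ∙ y)
      ∙-mem (inj₁ x≈ε) (inj₁ y≈ε) = inj₁ (trans (∙-cong x≈ε y≈ε) (identityˡ ε))
      ∙-mem (inj₁ x≈ε) (inj₂ y≈v) = inj₂ (trans (∙-cong x≈ε y≈v) (identityˡ v))
      ∙-mem (inj₂ x≈v) (inj₁ y≈ε) = inj₂ (trans (∙-cong x≈v y≈ε) (identityʳ v))
      ∙-mem (inj₂ x≈v) (inj₂ y≈v) = inj₁ (trans (∙-cong x≈v y≈v) v∙v≈ε)

    ⟨v⟩-exponent₂ : ∀ {x} → ⟨v⟩ x → x ∙ x ≈ ε
    ⟨v⟩-exponent₂ (inj₁ x≈ε) = trans (∙-cong x≈ε x≈ε) (identityˡ ε)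
    ⟨v⟩-exponent₂ (inj₂ x≈v) = trans (∙-cong x≈v x≈v) v∙v≈ε

  module _ {φ : Carrier → Carrier} (φ-mono : IsGroupMonomorphism rawGroup rawGroup φ) (φv≈v : φ v ≈ v) where
    open IsGroupMonomorphism φ-mono

    ⟨v⟩-fixed : ∀ {x} → ⟨v⟩ x → φ x ≈ x
    ⟨v⟩-fixed (inj₁ x≈ε) = trans (⟦⟧-cong x≈ε) (trans ε-homo (sym x≈ε))
    ⟨v⟩-fixed (inj₂ x≈v) = trans (⟦⟧-cong x≈v) (trans φv≈v (sym x≈v))

    ⟨v⟩-invariant : Invariant A φ ⟨v⟩
    ⟨v⟩-invariant (inj₁ x≈ε) = inj₁ (trans (⟦⟧-cong x≈ε) ε-homo)
    ⟨v⟩-invariant (inj₂ x≈v) = inj₂ (trans (⟦⟧-cong x≈v) φv≈v)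

    ⟨v⟩-reflected : ∀ {x} → ⟨v⟩ (φ x) → ⟨v⟩ x
    ⟨v⟩-reflected (inj₁ φx≈ε) = inj₁ (injective (trans φx≈ε (sym ε-homo)))
    ⟨v⟩-reflected (inj₂ φx≈v) = inj₂ (injective (trans φx≈v (sym φv≈v)))

module IndexTwo {a ℓ h} (A : AbelianGroup a ℓ) {H : Pred (AbelianGroup.Carrier A) h} (H-subgroup : IsSubgroup A H)
  {w : AbelianGroup.Carrier A} (w∉H : ¬ H w) (cosets : TwoCosets A H w) where
  open AbelianGroup A
  open IsSubgroup H-subgroup
  open GroupProperties group using (⁻¹-involutive; //-rightDividesˡ; //-rightDividesʳ)
  open AbelianGroupProperties A using (⁻¹-∙-comm)
  open CommutativeSemigroupProperties commutativeSemigroup using (interchange)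

  hasIndex₂ : HasIndex A H 2
  hasIndex₂ = (ε ∷ w ∷ []) , representative , distinct
    where
    representative : ∀ y → ∃ λ i → H (y ∙ (ε ∷ w ∷ []) i ⁻¹)
    representative y = [ (λ y∈H → 0F , resp (sym (x∙ε⁻¹≈x A y)) y∈H) , (λ y∈wH → 1F , y∈wH) ]′ (cosets y)
    distinct : ∀ i j → H ((ε ∷ w ∷ []) i ∙ (ε ∷ w ∷ []) j ⁻¹) → i ≡ j
    distinct 0F 0F _ = ≡.refl
    distinct 1F 1F _ = ≡.refl
    distinct 0F 1F h = ⊥-elim (w∉H (resp (trans (⁻¹-cong (identityˡ (w ⁻¹))) (⁻¹-involutive w)) (⁻¹-mem h)))
    distinct 1F 0F h = ⊥-elim (w∉H (resp (x∙ε⁻¹≈x A w) h))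

  w∙w∈H : H (w ∙ w)
  w∙w∈H = [ (λ ww∈H → ww∈H) , (λ www⁻¹∈H → ⊥-elim (w∉H (resp (//-rightDividesʳ w w) www⁻¹∈H))) ]′ (cosets (w ∙ w))

  square∈H : ∀ y → H (y ∙ y)
  square∈H y with cosets y
  ... | inj₁ y∈H = ∙-mem y∈H y∈H
  ... | inj₂ y∈wH = resp yy-split (∙-mem (∙-mem y∈wH y∈wH) w∙w∈H)
    where
    yy-split : ((y ∙ w ⁻¹) ∙ (y ∙ w ⁻¹)) ∙ (w ∙ w) ≈ y ∙ y
    yy-split = trans (interchange _ _ w w) (∙-cong (//-rightDividesˡ w y) (//-rightDividesˡ w y))

  module _ {φ : Carrier → Carrier} (φ-hom : IsGroupHomomorphism rawGroup rawGroup φ)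
    (H-invariant : Invariant A φ H) (H-reflected : ∀ {x} → H (φ x) → H x) where
    open IsGroupHomomorphism φ-hom

    displacement-homo : ∀ x y → φ (x ∙ y) ∙ (x ∙ y) ⁻¹ ≈ (φ x ∙ x ⁻¹) ∙ (φ y ∙ y ⁻¹)
    displacement-homo x y =
      trans (∙-cong (homo x y) (sym (⁻¹-∙-comm x y))) (interchange (φ x) (φ y) (x ⁻¹) (y ⁻¹))

    displacement∈H-of-∈H : ∀ {x} → H x → H (φ x ∙ x ⁻¹)
    displacement∈H-of-∈H x∈H = ∙-mem (H-invariant x∈H) (⁻¹-mem x∈H)

    displacement∈H : ∀ y → H (φ y ∙ y ⁻¹)
    displacement∈H y with cosets y
    ... | inj₁ y∈H = displacement∈H-of-∈H y∈H
    ... | inj₂ y∈wH = resp split (∙-mem (displacement∈H-of-∈H y∈wH) φw∙w⁻¹∈H)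
      where
      φw∙w⁻¹∈H : H (φ w ∙ w ⁻¹)
      φw∙w⁻¹∈H = [ (λ φw∈H → ⊥-elim (w∉H (H-reflected φw∈H))) , (λ φw∈wH → φw∈wH) ]′ (cosets (φ w))
      split : (φ (y ∙ w ⁻¹) ∙ (y ∙ w ⁻¹) ⁻¹) ∙ (φ w ∙ w ⁻¹) ≈ φ y ∙ y ⁻¹
      split = trans (sym (displacement-homo (y ∙ w ⁻¹) w))
                    (∙-cong (⟦⟧-cong (//-rightDividesˡ w y)) (⁻¹-cong (//-rightDividesˡ w y)))

module _ {a ℓ} (A : AbelianGroup a ℓ) where
  open AbelianGroup A

  -- If φ − 1 maps A into H, on which φ is trivial, then φᵏ y = dᵏ ∙ y for d = φ y ∙ y⁻¹.
  onePhi3≈ε : ∀ {h} {H : Pred Carrier h} {φ : Carrier → Carrier} → IsGroupHomomorphism rawGroup rawGroup φ →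
              (∀ y → H (y ∙ y)) → (∀ y → H (φ y ∙ y ⁻¹)) →
              (∀ {x} → H x → x ∙ x ≈ ε) → (∀ {x} → H x → φ x ≈ x) →
              ∀ y → onePhi3 A φ y ≈ ε
  onePhi3≈ε {φ = φ} φ-hom square∈H displacement∈H H-exponent₂ H-fixed y = begin
    y ∙ (φ y ∙ (φ (φ y) ∙ φ (φ (φ y))))                     ≈⟨ ∙-congˡ (∙-cong φ¹ (∙-cong φ² φ³)) ⟩
    y ∙ ((d ∙ y) ∙ ((d ∙ (d ∙ y)) ∙ (d ∙ (d ∙ (d ∙ y)))))   ≈⟨ regroup ⟩
    ((y ∙ y) ∙ (y ∙ y)) ∙ ((d ∙ d) ∙ ((d ∙ d) ∙ (d ∙ d)))   ≈⟨ ∙-cong (H-exponent₂ (square∈H y)) (∙-cong d∙d≈ε (∙-cong d∙d≈ε d∙d≈ε)) ⟩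
    ε ∙ (ε ∙ (ε ∙ ε))                                       ≈⟨ trans (identityˡ _) (trans (identityˡ _) (identityˡ ε)) ⟩
    ε                                                       ∎
    where
    open IsGroupHomomorphism φ-hom
    open GroupProperties group using (//-rightDividesˡ)
    open CommutativeMonoidSolver commutativeMonoid using (solve; _⊜_; _⊕_)
    open SetoidReasoning setoid
    d : Carrier
    d = φ y ∙ y ⁻¹
    d∙d≈ε : d ∙ d ≈ ε
    d∙d≈ε = H-exponent₂ (displacement∈H y)
    φ¹ : φ y ≈ d ∙ y
    φ¹ = sym (//-rightDividesˡ y (φ y))
    φ[d∙x]≈d∙φx : ∀ x → φ (d ∙ x) ≈ d ∙ φ x
    φ[d∙x]≈d∙φx x = trans (homo d x) (∙-congʳ (H-fixed (displacement∈H y)))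
    φ[d∙y] : φ (d ∙ y) ≈ d ∙ (d ∙ y)
    φ[d∙y] = trans (φ[d∙x]≈d∙φx y) (∙-congˡ φ¹)
    φ² : φ (φ y) ≈ d ∙ (d ∙ y)
    φ² = trans (⟦⟧-cong φ¹) φ[d∙y]
    φ³ : φ (φ (φ y)) ≈ d ∙ (d ∙ (d ∙ y))
    φ³ = trans (⟦⟧-cong φ²) (trans (φ[d∙x]≈d∙φx (d ∙ y)) (∙-congˡ φ[d∙y]))
    regroup : y ∙ ((d ∙ y) ∙ ((d ∙ (d ∙ y)) ∙ (d ∙ (d ∙ (d ∙ y))))) ≈ ((y ∙ y) ∙ (y ∙ y)) ∙ ((d ∙ d) ∙ ((d ∙ d) ∙ (d ∙ d)))
    regroup = solve 2 (λ y d → y ⊕ ((d ⊕ y) ⊕ ((d ⊕ (d ⊕ y)) ⊕ (d ⊕ (d ⊕ (d ⊕ y)))))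
                             ⊜ ((y ⊕ y) ⊕ (y ⊕ y)) ⊕ ((d ⊕ d) ⊕ ((d ⊕ d) ⊕ (d ⊕ d)))) refl y d

  3-cycle⇒3∣period : ∀ {f : Carrier → Carrier} → (∀ {x y} → x ≈ y → f x ≈ f y) →
                     ∀ {p q r} → f p ≈ q → f q ≈ r → f r ≈ p → ¬ p ≈ q → ¬ p ≈ r →
                     ∀ m → iter A m f p ≈ p → 3 ∣ m
  3-cycle⇒3∣period {f} f-cong {p} {q} {r} fp≈q fq≈r fr≈p p≉q p≉r m fᵐp≈p with position m
    where
    position : ∀ m → (iter A m f p ≈ p × 3 ∣ m)
                   ⊎ (iter A m f p ≈ q × 3 ∣ suc (suc m))
                   ⊎ (iter A m f p ≈ r × 3 ∣ suc m)
    position zero = inj₁ (refl , (3 ∣0))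
    position (suc m) with position m
    ... | inj₁ (at-p , 3∣m) = inj₂ (inj₁ (trans (f-cong at-p) fp≈q , ∣m∣n⇒∣m+n ∣-refl 3∣m))
    ... | inj₂ (inj₁ (at-q , 3∣m+2)) = inj₂ (inj₂ (trans (f-cong at-q) fq≈r , 3∣m+2))
    ... | inj₂ (inj₂ (at-r , 3∣m+1)) = inj₁ (trans (f-cong at-r) fr≈p , 3∣m+1)
  ... | inj₁ (_ , 3∣m) = 3∣m
  ... | inj₂ (inj₁ (at-q , _)) = contradiction (trans (sym fᵐp≈p) at-q) p≉q
  ... | inj₂ (inj₂ (at-r , _)) = contradiction (trans (sym fᵐp≈p) at-r) p≉r

module FourElementGroup {a ℓ} (A : AbelianGroup a ℓ) (E : Enumeration (AbelianGroup.setoid A) 4)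
  {φ : AbelianGroup.Carrier A → AbelianGroup.Carrier A}
  (φ-mono : IsGroupMonomorphism (AbelianGroup.rawGroup A) (AbelianGroup.rawGroup A) φ)
  (n : ℕ) (φⁿ≈id : IsIdentity A (iter A n φ)) (3∤n : ¬ 3 ∣ n) where
  open AbelianGroup A
  open IsGroupMonomorphism φ-mono
  open GroupProperties group using (∙-cancelˡ; ∙-cancelʳ; //-rightDividesʳ)
  open Injections setoid
  open Enumeration E
  open FiniteAbelianGroup A E
  open Involution A

  φx≈ε⇒x≈ε : ∀ {x} → φ x ≈ ε → x ≈ ε
  φx≈ε⇒x≈ε φx≈ε = injective (trans φx≈ε (sym ε-homo))

  module Complement {v : Carrier} (v≉ε : ¬ v ≈ ε) (v∙v≈ε : v ∙ v ≈ ε)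
                    {w : Carrier} (w≉ε : ¬ w ≈ ε) (w≉v : ¬ w ≈ v) where

    v∙w≉ε : ¬ v ∙ w ≈ ε
    v∙w≉ε vw≈ε = w≉v (∙-cancelˡ v w v (trans vw≈ε (sym v∙v≈ε)))

    v≉v∙w : ¬ v ≈ v ∙ w
    v≉v∙w v≈vw = w≉ε (sym (∙-cancelˡ v ε w (trans (identityʳ v) v≈vw)))

    w≉v∙w : ¬ w ≈ v ∙ w
    w≉v∙w w≈vw = v≉ε (sym (∙-cancelʳ w ε v (trans (identityˡ w) w≈vw)))

    elements : ∀ y → ∃ λ j → y ≈ (ε ∷ v ∷ w ∷ v ∙ w ∷ []) j
    elements = injective⇒surjective
      (∷-injective ε∉ (∷-injective v∉ (∷-injective w∉ (∷-injective (λ ()) (λ { {()} })))))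
      where
      ε∉ : ∀ j → ¬ ε ≈ (v ∷ w ∷ v ∙ w ∷ []) j
      ε∉ 0F e = v≉ε (sym e)
      ε∉ 1F e = w≉ε (sym e)
      ε∉ 2F e = v∙w≉ε (sym e)
      v∉ : ∀ j → ¬ v ≈ (w ∷ v ∙ w ∷ []) j
      v∉ 0F e = w≉v (sym e)
      v∉ 1F e = v≉v∙w e
      w∉ : ∀ j → ¬ w ≈ (v ∙ w ∷ []) j
      w∉ 0F e = w≉v∙w e

    cosets : ∀ y → ⟨v⟩ y ⊎ ⟨v⟩ (y ∙ w ⁻¹)
    cosets y with elements y
    ... | 0F , y≈ε = inj₁ (inj₁ y≈ε)
    ... | 1F , y≈v = inj₁ (inj₂ y≈v)
    ... | 2F , y≈w = inj₂ (inj₁ (trans (∙-congʳ y≈w) (inverseʳ w)))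
    ... | 3F , y≈vw = inj₂ (inj₂ (trans (∙-congʳ y≈vw) (//-rightDividesʳ w v)))

    open IndexTwo A (⟨v⟩-isSubgroup v∙v≈ε) [ w≉ε , w≉v ] cosets public

  record FixedInvolution : Set (a ⊔ ℓ) where
    constructor fixedInvolution
    field
      v     : Carrier
      v≉ε   : ¬ v ≈ ε
      v∙v≈ε : v ∙ v ≈ ε
      φv≈v  : φ v ≈ v

  -- All squares lie in ⟨x ∙ x⟩, so the nontrivial square φ x ∙ φ x must be x ∙ x.
  fixedInvolution-of-nonsquare : ∀ x → ¬ x ∙ x ≈ ε → FixedInvolution
  fixedInvolution-of-nonsquare x x∙x≉ε = φx∙φx-case (square∈H (φ x))
    where
    x∙x∙[x∙x]≈ε : (x ∙ x) ∙ (x ∙ x) ≈ ε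
    x∙x∙[x∙x]≈ε = trans (assoc x x (x ∙ x))
      (trans (∙-congˡ (∙-congˡ (∙-congˡ (sym (identityʳ x))))) (n·x≈ε x))
    x≉ε : ¬ x ≈ ε
    x≉ε x≈ε = x∙x≉ε (trans (∙-cong x≈ε x≈ε) (identityˡ ε))
    x≉x∙x : ¬ x ≈ x ∙ x
    x≉x∙x x≈xx = x≉ε (sym (∙-cancelˡ x ε x (trans (identityʳ x) x≈xx)))
    open Complement x∙x≉ε x∙x∙[x∙x]≈ε x≉ε x≉x∙x
    φx∙φx-case : ⟨v⟩ (φ x ∙ φ x) → FixedInvolution
    φx∙φx-case (inj₁ φxφx≈ε) = ⊥-elim (x∙x≉ε (φx≈ε⇒x≈ε (trans (∙-homo x x) φxφx≈ε)))
    φx∙φx-case (inj₂ φxφx≈xx) = fixedInvolution (x ∙ x) x∙x≉ε x∙x∙[x∙x]≈ε (trans (∙-homo x x) φxφx≈xx)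

  -- φ permutes the three involutions a, b, a ∙ b, and 3 ∤ n rules out a 3-cycle.
  module Klein (y∙y≈ε : ∀ y → y ∙ y ≈ ε) {a b : Carrier} (a≉ε : ¬ a ≈ ε) (b≉ε : ¬ b ≈ ε) (b≉a : ¬ b ≈ a) where
    open Complement a≉ε (y∙y≈ε a) b≉ε b≉a renaming (v∙w≉ε to a∙b≉ε; v≉v∙w to a≉a∙b)

    a≉b : ¬ a ≈ b
    a≉b a≈b = b≉a (sym a≈b)

    x∙y∙y≈x : ∀ x y → (x ∙ y) ∙ y ≈ x
    x∙y∙y≈x x y = trans (assoc x y y) (trans (∙-congˡ (y∙y≈ε y)) (identityʳ x))

    3∣n-of-3-cycle : ∀ {p q r} → φ p ≈ q → φ q ≈ r → φ r ≈ p → ¬ p ≈ q → ¬ p ≈ r → 3 ∣ n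
    3∣n-of-3-cycle φp≈q φq≈r φr≈p p≉q p≉r =
      3-cycle⇒3∣period A ⟦⟧-cong φp≈q φq≈r φr≈p p≉q p≉r n (φⁿ≈id _)

    fixedInvolution-exists : FixedInvolution
    fixedInvolution-exists with elements (φ a) | elements (φ b)
    ... | 0F , φa≈ε | _ = ⊥-elim (a≉ε (φx≈ε⇒x≈ε φa≈ε))
    ... | _ | 0F , φb≈ε = ⊥-elim (b≉ε (φx≈ε⇒x≈ε φb≈ε))
    ... | 1F , φa≈a | _ = fixedInvolution a a≉ε (y∙y≈ε a) φa≈a
    ... | _ | 2F , φb≈b = fixedInvolution b b≉ε (y∙y≈ε b) φb≈b
    ... | 2F , φa≈b | 1F , φb≈a = fixedInvolution (a ∙ b) a∙b≉ε (y∙y≈ε (a ∙ b)) φab≈ab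
      where
      φab≈ab : φ (a ∙ b) ≈ a ∙ b
      φab≈ab = trans (∙-homo a b) (trans (∙-cong φa≈b φb≈a) (comm b a))
    ... | 2F , φa≈b | 3F , φb≈ab = contradiction (3∣n-of-3-cycle φa≈b φb≈ab φab≈a a≉b a≉a∙b) 3∤n
      where
      φab≈a : φ (a ∙ b) ≈ a
      φab≈a = trans (∙-homo a b) (trans (∙-cong φa≈b φb≈ab) (trans (comm b (a ∙ b)) (x∙y∙y≈x a b)))
    ... | 3F , φa≈ab | 1F , φb≈a = contradiction (3∣n-of-3-cycle φa≈ab φab≈b φb≈a a≉a∙b a≉b) 3∤n
      where
      φab≈b : φ (a ∙ b) ≈ b
      φab≈b = trans (∙-homo a b) (trans (∙-cong φa≈ab φb≈a) (trans (∙-congʳ (comm a b)) (x∙y∙y≈x b a)))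
    ... | 3F , φa≈ab | 3F , φb≈ab = ⊥-elim (b≉a (injective (trans φb≈ab (sym φa≈ab))))

  fixedInvolution-exists : FixedInvolution
  fixedInvolution-exists with Fin.any? (λ i → ¬? (element i ∙ element i ≟ ε))
  ... | yes (i , nonsquare) = fixedInvolution-of-nonsquare (element i) nonsquare
  ... | no no-nonsquare with ∃-missing (s≤s (s≤s z≤n)) (ε ∷ [])
  ...   | a , a∉ with ∃-missing (s≤s (s≤s (s≤s z≤n))) (ε ∷ a ∷ [])
  ...     | b , b∉ = Klein.fixedInvolution-exists y∙y≈ε (a∉ 0F) (b∉ 0F) (b∉ 1F)
    where
    y∙y≈ε : ∀ y → y ∙ y ≈ ε
    y∙y≈ε y with element-surjective y
    ... | i , y≈eᵢ = trans (∙-cong y≈eᵢ y≈eᵢ)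
                       (decidable-stable (element i ∙ element i ≟ ε) (λ nonsquare → no-nonsquare (i , nonsquare)))

  theorem : Σ (Pred Carrier ℓ) λ H → IsSubgroup A H × Invariant A φ H × HasIndex A H 2
                                     × ImageIn A (onePhi3 A φ) (_≈ ε)
  theorem with fixedInvolution-exists
  ... | fixedInvolution v v≉ε v∙v≈ε φv≈v with ∃-missing (s≤s (s≤s (s≤s z≤n))) (ε ∷ v ∷ [])
  ...   | w , w∉ = ⟨v⟩ , ⟨v⟩-isSubgroup v∙v≈ε , ⟨v⟩-invariant φ-mono φv≈v , hasIndex₂ , image
    where
    open Complement v≉ε v∙v≈ε (w∉ 0F) (w∉ 1F)
    image : ImageIn A (onePhi3 A φ) (_≈ ε)
    image = onePhi3≈ε A isGroupHomomorphism square∈H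
              (displacement∈H isGroupHomomorphism (⟨v⟩-invariant φ-mono φv≈v) (⟨v⟩-reflected φ-mono φv≈v))
              (⟨v⟩-exponent₂ v∙v≈ε) (⟨v⟩-fixed φ-mono φv≈v)

module _ {c ℓ} (G : AbelianGroup c ℓ) {φ : AbelianGroup.Carrier G → AbelianGroup.Carrier G} where
  open AbelianGroup G

  iter-shift : ∀ m x → iter G m φ (φ x) ≡ iter G (suc m) φ x
  iter-shift zero    x = ≡.refl
  iter-shift (suc m) x = ≡.cong φ (iter-shift m x)

  invariant-iter : ∀ {p} {P : Pred Carrier p} → Invariant G φ P → ∀ m {x} → P x → P (iter G m φ x)
  invariant-iter             P-invariant zero    Px = Px
  invariant-iter {P = P} P-invariant (suc m) Px =
    P-invariant (invariant-iter {P = P} P-invariant m Px)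

  -- φ⁻¹ = φⁿ⁻¹.
  invariant⇒reflected : ∀ {p} {P : Pred Carrier p} {n} → (∀ {x y} → x ≈ y → P x → P y) →
                        Invariant G φ P → HasOrder G φ n → ∀ {x} → P (φ x) → P x
  invariant⇒reflected {P = P} {n = suc m} P-resp P-invariant (_ , φⁿ≈id , _) {x} Pφx =
    P-resp (φⁿ≈id x) (≡.subst P (iter-shift m x) (invariant-iter {P = P} P-invariant m Pφx))

module Quotient {c ℓ p} (G : AbelianGroup c ℓ) {K : Pred (AbelianGroup.Carrier G) p} (K-subgroup : IsSubgroup G K) where
  open AbelianGroup G
  open IsSubgroup K-subgroup
  open GroupProperties group using (⁻¹-anti-homo-∙; ⁻¹-involutive; x≈y⇒x∙y⁻¹≈ε; //-rightDividesˡ)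
  open AbelianGroupProperties G using (⁻¹-∙-comm)
  open CommutativeSemigroupProperties commutativeSemigroup using (interchange)

  infix 4 _~_
  _~_ : Carrier → Carrier → Set p
  x ~ y = K (x ∙ y ⁻¹)

  ≈⇒~ : ∀ {x y} → x ≈ y → x ~ y
  ≈⇒~ x≈y = resp (sym (x≈y⇒x∙y⁻¹≈ε x≈y)) ε-mem

  ~-sym : ∀ {x y} → x ~ y → y ~ x
  ~-sym {x} {y} x~y = resp (trans (⁻¹-anti-homo-∙ x (y ⁻¹)) (∙-congʳ (⁻¹-involutive y))) (⁻¹-mem x~y)

  ~-trans : ∀ {x y z} → x ~ y → y ~ z → x ~ z
  ~-trans {x} {y} {z} x~y y~z = resp
    (trans (sym (assoc _ y (z ⁻¹))) (∙-congʳ (//-rightDividesˡ y x))) (∙-mem x~y y~z)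

  ∙-cong/K : ∀ {x x′ y y′} → x ~ x′ → y ~ y′ → x ∙ y ~ x′ ∙ y′
  ∙-cong/K {x} {x′} {y} {y′} x~x′ y~y′ =
    resp (trans (interchange x (x′ ⁻¹) y (y′ ⁻¹)) (∙-congˡ (⁻¹-∙-comm x′ y′))) (∙-mem x~x′ y~y′)

  ⁻¹-cong/K : ∀ {x y} → x ~ y → x ⁻¹ ~ y ⁻¹
  ⁻¹-cong/K {x} {y} x~y = resp (sym (⁻¹-∙-comm x (y ⁻¹))) (⁻¹-mem x~y)

  G/K : AbelianGroup c p
  G/K = record
    { Carrier = Carrier ; _≈_ = _~_ ; _∙_ = _∙_ ; ε = ε ; _⁻¹ = _⁻¹
    ; isAbelianGroup = record
      { isGroup = record
        { isMonoid = record
          { isSemigroup = record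
            { isMagma = record
              { isEquivalence = record { refl = ≈⇒~ refl ; sym = ~-sym ; trans = ~-trans }
              ; ∙-cong = ∙-cong/K }
            ; assoc = λ x y z → ≈⇒~ (assoc x y z) }
          ; identity = (λ x → ≈⇒~ (identityˡ x)) , (λ x → ≈⇒~ (identityʳ x)) }
        ; inverse = (λ x → ≈⇒~ (inverseˡ x)) , (λ x → ≈⇒~ (inverseʳ x))
        ; ⁻¹-cong = ⁻¹-cong/K }
      ; comm = λ x y → ≈⇒~ (comm x y) } }

  module G/K = AbelianGroup G/K

  hasIndex⇒enumeration : ∀ {n} → HasIndex G K n → Enumeration G/K.setoid n
  hasIndex⇒enumeration (g , g-surjective , g-injective) = record
    { element = g ; element-injective = λ {i} {j} → g-injective i j ; element-surjective = g-surjective }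

  iter/K≡iter : ∀ m (f : Carrier → Carrier) x → iter G/K m f x ≡ iter G m f x
  iter/K≡iter zero    f x = ≡.refl
  iter/K≡iter (suc m) f x = ≡.cong f (iter/K≡iter m f x)

  isSubgroup-lift : ∀ {h} {H : Pred Carrier h} → IsSubgroup G/K H → IsSubgroup G H
  isSubgroup-lift H-subgroup = record
    { resp = λ x≈y → resp/K (≈⇒~ x≈y) ; ε-mem = ε-mem/K ; ∙-mem = ∙-mem/K ; ⁻¹-mem = ⁻¹-mem/K }
    where open IsSubgroup H-subgroup renaming (resp to resp/K; ε-mem to ε-mem/K; ∙-mem to ∙-mem/K; ⁻¹-mem to ⁻¹-mem/K)

  ⊆-lift : ∀ {h} {H : Pred Carrier h} → IsSubgroup G/K H → K ⊆ H
  ⊆-lift H-subgroup k = resp/K (~-sym (resp (sym (x∙ε⁻¹≈x G _)) k)) ε-mem/K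
    where open IsSubgroup H-subgroup renaming (resp to resp/K; ε-mem to ε-mem/K)

  imageIn-lift : ∀ {f} → ImageIn G/K f (_~ ε) → ImageIn G f K
  imageIn-lift fy~ε y = resp (x∙ε⁻¹≈x G _) (fy~ε y)

  module _ {φ : Carrier → Carrier} (φ-auto : IsAutomorphism G φ) (K-invariant : Invariant G φ K)
           (K-reflected : ∀ {x} → K (φ x) → K x) where
    open GroupMorphisms.IsGroupIsomorphism φ-auto

    φ-cong/K : ∀ {x y} → x ~ y → φ x ~ φ y
    φ-cong/K {x} {y} x~y = resp (trans (∙-homo x (y ⁻¹)) (∙-congˡ (⁻¹-homo y))) (K-invariant x~y)

    quotient-monomorphism : IsGroupMonomorphism G/K.rawGroup G/K.rawGroup φ
    quotient-monomorphism = record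
      { isGroupHomomorphism = record
        { isMonoidHomomorphism = record
          { isMagmaHomomorphism = record
            { isRelHomomorphism = record { cong = φ-cong/K }
            ; homo = λ x y → ≈⇒~ (∙-homo x y) }
          ; ε-homo = ≈⇒~ ε-homo }
        ; ⁻¹-homo = λ x → ≈⇒~ (⁻¹-homo x) }
      ; injective = λ {x} {y} φx~φy →
          K-reflected (resp (sym (trans (∙-homo x (y ⁻¹)) (∙-congˡ (⁻¹-homo y)))) φx~φy) }

mainTheorem5 : {c ℓ p : Level} (G : AbelianGroup c ℓ) (φ : AbelianGroup.Carrier G → AbelianGroup.Carrier G)
    → IsAutomorphism G φ
    → (n : ℕ) → HasOrder G φ n → ¬ (3 ∣ n)
    → (K : Pred (AbelianGroup.Carrier G) p) → IsSubgroup G K → Invariant G φ K → HasIndex G K 4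
    → (Σ (Pred (AbelianGroup.Carrier G) p) λ H →
          IsSubgroup G H × Invariant G φ H × HasIndex G H 2 × (K ⊆ H))
      × ImageIn G (onePhi3 G φ) K
mainTheorem5 G φ φ-auto n φ-order 3∤n K K-subgroup K-invariant K-index₄ =
  let H , H-subgroup , H-invariant , H-index₂ , image =
        FourElementGroup.theorem G/K (hasIndex⇒enumeration K-index₄) φ-mono/K n φⁿ≈id/K 3∤n
  in (H , isSubgroup-lift H-subgroup , H-invariant , H-index₂ , ⊆-lift H-subgroup) , imageIn-lift image
  where
  open IsSubgroup K-subgroup using (resp)
  open Quotient G K-subgroup
  φ-mono/K : IsGroupMonomorphism G/K.rawGroup G/K.rawGroup φ
  φ-mono/K = quotient-monomorphism φ-auto K-invariant (invariant⇒reflected G resp K-invariant φ-order)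
  φⁿ≈id/K : IsIdentity G/K (iter G/K n φ)
  φⁿ≈id/K x = ≡.subst (_~ x) (≡.sym (iter/K≡iter n φ x)) (≈⇒~ (proj₁ (proj₂ φ-order) x))
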